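{- The generalized Johnson graph $J(7,3,1)$ is a vertex-transitive CIS graph which is not localizable.
   Context: For integers $n>k>i\ge 0$, the generalized Johnson graph $J(n,k,i)$ has as vertices all $k$-element subsets of $\{1,\dots,n\}$, two vertices being adjacent iff their intersection has exactly $i$ elements. A clique is strong if it intersects every inclusion-maximal independent set. A graph is CIS if every inclusion-maximal clique is strong, and localizable if its vertex set can be partitioned into strong cliques. A graph is vertex-transitive if its automorphism group acts transitively on its vertices. -}

module Defs where

open import Data.Nat using (ℕ; _<_)
open import Data.Nat.Properties using (_≟_)
open import Data.Bool using (Bool; true; false)
open import Data.Fin.Subset using (Subset; ∣_∣; _∩_)
open import Data.Product using (Σ; ∃; _×_; _,_; proj₁)
open import Relation.Nullary using (¬_)
open import Relation.Nullary.Decidable using (⌊_⌋)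
open import Relation.Binary.PropositionalEquality using (_≡_; _≢_)
open import Function.Bundles using (_↔_; Inverse)

record Graph : Set₁ where
  field
    Vertex : Set
    _~_    : Vertex → Vertex → Set

module _ (G : Graph) where
  open Graph G

  VSet : Set
  VSet = Vertex → Bool

  _∈_ : Vertex → VSet → Set
  v ∈ S = S v ≡ true

  _⊆_ : VSet → VSet → Set
  S ⊆ T = ∀ v → v ∈ S → v ∈ T

  IsClique : VSet → Set
  IsClique C = ∀ u v → u ∈ C → v ∈ C → u ≢ v → u ~ v

  IsIndependent : VSet → Set
  IsIndependent I = ∀ u v → u ∈ I → v ∈ I → ¬ (u ~ v)

  IsMaximalClique : VSet → Set
  IsMaximalClique C = IsClique C × (∀ D → IsClique D → C ⊆ D → D ⊆ C)

  IsMaximalIndependent : VSet → Set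
  IsMaximalIndependent I =
    IsIndependent I × (∀ J → IsIndependent J → I ⊆ J → J ⊆ I)

  IsStrongClique : VSet → Set
  IsStrongClique C =
    IsClique C × (∀ I → IsMaximalIndependent I → ∃ λ v → v ∈ C × v ∈ I)

  IsCIS : Set
  IsCIS = ∀ C → IsMaximalClique C → IsStrongClique C

  -- localizable: the vertex set can be partitioned into strong cliques.
  -- A partition is given by a block-labelling c : Vertex → ℕ; the block
  -- containing v is { u ∣ c u = c v }, and every block must be a strong clique.
  block : (Vertex → ℕ) → Vertex → VSet
  block c v u = ⌊ c u ≟ c v ⌋

  IsLocalizable : Set
  IsLocalizable = ∃ λ (c : Vertex → ℕ) → ∀ v → IsStrongClique (block c v)

  IsAutomorphism : (Vertex ↔ Vertex) → Set
  IsAutomorphism f =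
    ∀ u v → (u ~ v → Inverse.to f u ~ Inverse.to f v)
          × (Inverse.to f u ~ Inverse.to f v → u ~ v)

  IsVertexTransitive : Set
  IsVertexTransitive =
    ∀ u v → ∃ λ (f : Vertex ↔ Vertex) → IsAutomorphism f × Inverse.to f u ≡ v

J : ℕ → ℕ → ℕ → Graph
J n k i = record
  { Vertex = Σ (Subset n) (λ s → ∣ s ∣ ≡ k)
  ; _~_    = λ s t → ∣ proj₁ s ∩ proj₁ t ∣ ≡ i
  }

-- Every Johnson graph is vertex-transitive: adjacent transpositions of points are automorphisms,
-- and they sort any k-subset into the first k points.
-- The maximal cliques of J(7,3,1) are the 30 Fano planes on seven points and every maximal
-- independent set meets each of them, so the graph is CIS; both facts are verified by enumerating
-- maximal cliques and maximal independent sets. Since every vertex lies in a maximal independent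
-- set, a strong clique is maximal, so a localization would partition the 35 triples into Fano
-- planes. But two Fano planes miss some triple, and no three Fano planes are pairwise disjoint.

module Submission where

open import Defs hiding (_∈_; _⊆_)
open import Data.Bool using (Bool; true; false; T; _∧_; _∨_)
import Data.Bool as Bool
open import Data.Bool.Properties using (T-∧; T-≡; ∨-zeroʳ)
open import Data.Empty using (⊥; ⊥-elim)
open import Data.Fin.Subset using (Subset; ∣_∣; _∩_)
open import Data.Fin.Subset.Properties using (∣p∣≤n; ∩-comm; ∩-idem)
open import Data.List using (List; []; _∷_; foldr; map; _++_; filter; length)
open import Data.List.Properties using (foldr-++)
open import Data.List.Membership.Propositional using (_∈_; _∉_; find)
open import Data.List.Membership.Propositional.Properties using (∈-++⁺ˡ; ∈-++⁺ʳ; ∈-map⁺; ∈-filter⁺)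
open import Data.List.Relation.Unary.All as All using (All; []; _∷_; all?)
open import Data.List.Relation.Unary.All.Properties using (all-filter; filter⁺)
open import Data.List.Relation.Unary.Any using (Any; here; there; any?)
open import Data.Nat using (ℕ; zero; suc; _≤_; z≤n; s≤s; _+_; _*_)
open import Data.Nat.Properties using (_≟_; ≡-irrelevant)
open import Data.Product using (Σ; ∃; _×_; _,_; proj₁; proj₂)
open import Data.Product.Properties using (Σ-≡,≡→≡)
open import Data.Sum using (_⊎_; inj₁; inj₂; [_,_])
open import Data.Vec using (Vec; []; _∷_; zipWith)
open import Data.Vec.Properties using (≡-dec)
open import Function using (_∘_; id; case_of_)
open import Function.Bundles using (_↔_; Inverse; mk↔ₛ′; Equivalence; _⇔_; mk⇔)
open import Function.Construct.Composition using (_↔-∘_; _⇔-∘_)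
open import Function.Construct.Identity using (↔-id)
open import Function.Construct.Symmetry using (↔-sym; ⇔-sym)
open import Relation.Binary using (Rel; Decidable; DecidableEquality; Reflexive; Symmetric)
open import Relation.Binary.PropositionalEquality using (_≡_; _≢_; refl; sym; trans; cong; subst; subst₂)
open import Relation.Nullary using (¬_; Dec; yes; no; does; _×-dec_; _⊎-dec_; ¬?)
open import Relation.Nullary.Decidable using (dec-true; toWitness; fromWitness; _→-dec_)
import Relation.Nullary.Decidable as Dec
open import Relation.Unary using (Pred)
import Relation.Unary

module _ {G : Graph} where
  open Graph G
  open Inverse

  automorphism-id : IsAutomorphism G (↔-id Vertex)
  automorphism-id u v = id , id

  automorphism-∘ : ∀ {f g} → IsAutomorphism G f → IsAutomorphism G g → IsAutomorphism G (g ↔-∘ f)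
  automorphism-∘ {f} {g} auto-f auto-g u v =
    (λ a → proj₁ (auto-g _ _) (proj₁ (auto-f u v) a)) ,
    (λ a → proj₂ (auto-f u v) (proj₂ (auto-g _ _) a))

  automorphism-sym : ∀ {f} → IsAutomorphism G f → IsAutomorphism G (↔-sym f)
  automorphism-sym {f} auto-f u v = preserve , reflect
    where
    preserve : u ~ v → from f u ~ from f v
    preserve a = proj₂ (auto-f (from f u) (from f v))
      (subst₂ _~_ (sym (strictlyInverseˡ f u)) (sym (strictlyInverseˡ f v)) a)
    reflect : from f u ~ from f v → u ~ v
    reflect a = subst₂ _~_ (strictlyInverseˡ f u) (strictlyInverseˡ f v) (proj₁ (auto-f _ _) a)

  vertexTransitive-byNormalisation : (ρ : Vertex → Vertex ↔ Vertex) → (∀ u → IsAutomorphism G (ρ u))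
                                   → (∀ u v → to (ρ u) u ≡ to (ρ v) v) → IsVertexTransitive G
  vertexTransitive-byNormalisation ρ auto-ρ same u v =
    ↔-sym (ρ v) ↔-∘ ρ u ,
    automorphism-∘ {ρ u} {↔-sym (ρ v)} (auto-ρ u) (automorphism-sym {ρ v} (auto-ρ v)) ,
    trans (cong (from (ρ v)) (same u v)) (strictlyInverseʳ (ρ v) v)

  strongClique⇒maximal : (∀ v → ∃ λ I → IsMaximalIndependent G I × I v ≡ true)
                       → ∀ {C} → IsStrongClique G C → IsMaximalClique G C
  strongClique⇒maximal inMaximalIndependent {C} (clique-C , meets) = clique-C , maximal
    where
    maximal : ∀ D → IsClique G D → (∀ v → C v ≡ true → D v ≡ true) → ∀ v → D v ≡ true → C v ≡ true
    maximal D clique-D C⊆D v v∈D with C v in Cv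
    ... | true = refl
    ... | false with inMaximalIndependent v
    ...   | I , maximal-I@(independent-I , _) , v∈I with meets I maximal-I
    ...     | u , u∈C , u∈I = ⊥-elim (independent-I u v u∈I v∈I (clique-D u v (C⊆D u u∈C) v∈D u≢v))
      where
      u≢v : u ≢ v
      u≢v refl = case trans (sym u∈C) Cv of λ ()

  ∈block⇔ : ∀ (c : Vertex → ℕ) v u → block G c v u ≡ true ⇔ c u ≡ c v
  ∈block⇔ c v u =
    mk⇔ (λ u∈ → toWitness (Equivalence.from T-≡ u∈)) (λ cu≡cv → Equivalence.to T-≡ (fromWitness cu≡cv))

module _ {a} {A : Set a} where

  swapAt : ∀ {n} → ℕ → Vec A n → Vec A n
  swapAt zero    (x ∷ y ∷ xs) = y ∷ x ∷ xs
  swapAt (suc i) (x ∷ xs)     = x ∷ swapAt i xs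
  swapAt _       xs           = xs

  swapAt-involutive : ∀ {n} i (xs : Vec A n) → swapAt i (swapAt i xs) ≡ xs
  swapAt-involutive zero    (x ∷ y ∷ xs) = refl
  swapAt-involutive zero    []           = refl
  swapAt-involutive zero    (x ∷ [])     = refl
  swapAt-involutive (suc i) []           = refl
  swapAt-involutive (suc i) (x ∷ xs)     = cong (x ∷_) (swapAt-involutive i xs)

  swapAt-zipWith : ∀ {n} (f : A → A → A) i (xs ys : Vec A n)
                 → swapAt i (zipWith f xs ys) ≡ zipWith f (swapAt i xs) (swapAt i ys)
  swapAt-zipWith f zero    (x ∷ y ∷ xs) (x′ ∷ y′ ∷ ys) = refl
  swapAt-zipWith f zero    []           []             = refl
  swapAt-zipWith f zero    (x ∷ [])     (x′ ∷ [])      = refl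
  swapAt-zipWith f (suc i) []           []             = refl
  swapAt-zipWith f (suc i) (x ∷ xs)     (x′ ∷ ys)      = cong (f x x′ ∷_) (swapAt-zipWith f i xs ys)

∣swapAt∣ : ∀ {n} i (p : Subset n) → ∣ swapAt i p ∣ ≡ ∣ p ∣
∣swapAt∣ zero    (true  ∷ true  ∷ p) = refl
∣swapAt∣ zero    (true  ∷ false ∷ p) = refl
∣swapAt∣ zero    (false ∷ true  ∷ p) = refl
∣swapAt∣ zero    (false ∷ false ∷ p) = refl
∣swapAt∣ zero    []                  = refl
∣swapAt∣ zero    (x ∷ [])            = refl
∣swapAt∣ (suc i) []                  = refl
∣swapAt∣ (suc i) (true  ∷ p)         = cong suc (∣swapAt∣ i p)
∣swapAt∣ (suc i) (false ∷ p)         = ∣swapAt∣ i p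

swaps : ∀ {n} → List ℕ → Subset n → Subset n
swaps w p = foldr swapAt p w

infix 4 _⇝_
_⇝_ : ∀ {n} → Subset n → Subset n → Set
p ⇝ q = ∃ λ w → swaps w p ≡ q

⇝-refl : ∀ {n} {p : Subset n} → p ⇝ p
⇝-refl = [] , refl

⇝-trans : ∀ {n} {p q r : Subset n} → p ⇝ q → q ⇝ r → p ⇝ r
⇝-trans {p = p} (w₁ , p↦q) (w₂ , q↦r) =
  w₂ ++ w₁ , trans (foldr-++ swapAt p w₂ w₁) (trans (cong (swaps w₂) p↦q) q↦r)

swaps-map-suc : ∀ {n} w x (p : Subset n) → swaps (map suc w) (x ∷ p) ≡ x ∷ swaps w p
swaps-map-suc []      x p = refl
swaps-map-suc (i ∷ w) x p = cong (swapAt (suc i)) (swaps-map-suc w x p)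

⇝-∷ : ∀ {n} x {p q : Subset n} → p ⇝ q → x ∷ p ⇝ x ∷ q
⇝-∷ x {p} (w , p↦q) = map suc w , trans (swaps-map-suc w x p) (cong (x ∷_) p↦q)

packed : ∀ n → ℕ → Subset n
packed zero    _       = []
packed (suc n) zero    = false ∷ packed n zero
packed (suc n) (suc k) = true ∷ packed n k

false∷packed⇝packed : ∀ {n k} → k ≤ n → false ∷ packed n k ⇝ packed (suc n) k
false∷packed⇝packed z≤n                       = ⇝-refl
false∷packed⇝packed {suc n} {suc k} (s≤s k≤n) =
  ⇝-trans (0 ∷ [] , refl) (⇝-∷ true (false∷packed⇝packed k≤n))

⇝packed : ∀ {n} (p : Subset n) → p ⇝ packed n ∣ p ∣
⇝packed []          = ⇝-refl
⇝packed (true  ∷ p) = ⇝-∷ true (⇝packed p)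
⇝packed (false ∷ p) = ⇝-trans (⇝-∷ false (⇝packed p)) (false∷packed⇝packed (∣p∣≤n p))

SubsetOfSize : ℕ → ℕ → Set
SubsetOfSize n k = Σ (Subset n) λ p → ∣ p ∣ ≡ k

insideCons : ∀ {n k} → SubsetOfSize n k → SubsetOfSize (suc n) (suc k)
insideCons (p , ∣p∣≡k) = true ∷ p , cong suc ∣p∣≡k

outsideCons : ∀ {n k} → SubsetOfSize n k → SubsetOfSize (suc n) k
outsideCons (p , ∣p∣≡k) = false ∷ p , ∣p∣≡k

subsetsOfSize : ∀ n k → List (SubsetOfSize n k)
subsetsOfSize zero    zero    = ([] , refl) ∷ []
subsetsOfSize zero    (suc k) = []
subsetsOfSize (suc n) zero    = map outsideCons (subsetsOfSize n zero)
subsetsOfSize (suc n) (suc k) = map insideCons (subsetsOfSize n k) ++ map outsideCons (subsetsOfSize n (suc k))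

∈-outsideCons : ∀ {n k} {p : SubsetOfSize n k} → p ∈ subsetsOfSize n k → outsideCons p ∈ subsetsOfSize (suc n) k
∈-outsideCons {k = zero}  p∈ = ∈-map⁺ outsideCons p∈
∈-outsideCons {n} {suc k} p∈ = ∈-++⁺ʳ (map insideCons (subsetsOfSize n k)) (∈-map⁺ outsideCons p∈)

∈-subsetsOfSize : ∀ {n k} (p : SubsetOfSize n k) → p ∈ subsetsOfSize n k
∈-subsetsOfSize ([] , refl)          = here refl
∈-subsetsOfSize (true  ∷ p , refl) = ∈-++⁺ˡ (∈-map⁺ insideCons (∈-subsetsOfSize (p , refl)))
∈-subsetsOfSize (false ∷ p , refl) = ∈-outsideCons (∈-subsetsOfSize (p , refl))

module Johnson (n k m : ℕ) where
  open Graph (J n k m)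
  open Inverse

  vertex-≡ : ∀ {u v : Vertex} → proj₁ u ≡ proj₁ v → u ≡ v
  vertex-≡ {u} {v} refl = Σ-≡,≡→≡ (refl , ≡-irrelevant _ _)

  _≟ᵥ_ : DecidableEquality Vertex
  u ≟ᵥ v = Dec.map′ vertex-≡ (cong proj₁) (≡-dec Bool._≟_ (proj₁ u) (proj₁ v))

  _~?_ : Decidable _~_
  (p , _) ~? (q , _) = ∣ p ∩ q ∣ ≟ m

  swapAut : ℕ → Vertex ↔ Vertex
  swapAut i = mk↔ₛ′ swap swap involutive involutive
    where
    swap : Vertex → Vertex
    swap (p , ∣p∣≡k) = swapAt i p , trans (∣swapAt∣ i p) ∣p∣≡k
    involutive : ∀ u → swap (swap u) ≡ u
    involutive (p , _) = vertex-≡ (swapAt-involutive i p)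

  swapAut-automorphism : ∀ i → IsAutomorphism (J n k m) (swapAut i)
  swapAut-automorphism i (p , _) (q , _) = trans ∣swap∩swap∣ , trans (sym ∣swap∩swap∣)
    where
    ∣swap∩swap∣ : ∣ swapAt i p ∩ swapAt i q ∣ ≡ ∣ p ∩ q ∣
    ∣swap∩swap∣ = trans (cong ∣_∣ (sym (swapAt-zipWith _ i p q))) (∣swapAt∣ i (p ∩ q))

  wordAut : List ℕ → Vertex ↔ Vertex
  wordAut = foldr (λ i f → swapAut i ↔-∘ f) (↔-id Vertex)

  wordAut-automorphism : ∀ w → IsAutomorphism (J n k m) (wordAut w)
  wordAut-automorphism []      = automorphism-id
  wordAut-automorphism (i ∷ w) =
    automorphism-∘ {f = wordAut w} {g = swapAut i} (wordAut-automorphism w) (swapAut-automorphism i)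

  wordAut-swaps : ∀ w u → proj₁ (to (wordAut w) u) ≡ swaps w (proj₁ u)
  wordAut-swaps []      u = refl
  wordAut-swaps (i ∷ w) u = cong (swapAt i) (wordAut-swaps w u)

  vertexTransitive : IsVertexTransitive (J n k m)
  vertexTransitive = vertexTransitive-byNormalisation normalise
    (λ u → wordAut-automorphism (word u)) (λ u v → vertex-≡ (trans (packs u) (sym (packs v))))
    where
    word : Vertex → List ℕ
    word (p , _) = proj₁ (⇝packed p)
    normalise : Vertex → Vertex ↔ Vertex
    normalise u = wordAut (word u)
    packs : ∀ u → proj₁ (to (normalise u) u) ≡ packed n k
    packs u@(p , refl) = trans (wordAut-swaps (word u) u) (proj₂ (⇝packed p))

does-true : ∀ {p} {P : Set p} (p? : Dec P) → does p? ≡ true → P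
does-true (yes p) _ = p

module Enumerated {A : Set} (_≟_ : DecidableEquality A)
                  (elements : List A) (complete : ∀ x → x ∈ elements) where
  open import Data.List.Membership.DecPropositional _≟_ using (_∈?_)

  ⟦_⟧ : List A → A → Bool
  ⟦ L ⟧ x = does (x ∈? L)

  ∈⇒∈⟦⟧ : ∀ {x L} → x ∈ L → ⟦ L ⟧ x ≡ true
  ∈⇒∈⟦⟧ {x} {L} = dec-true (x ∈? L)

  ∈⟦⟧⇒∈ : ∀ {x L} → ⟦ L ⟧ x ≡ true → x ∈ L
  ∈⟦⟧⇒∈ {x} {L} = does-true (x ∈? L)

  module RCliques {r} {R : Rel A r} (R? : Decidable R) (R-refl : Reflexive R) (R-sym : Symmetric R) where

    IsRClique : (A → Bool) → Set r
    IsRClique S = ∀ x y → S x ≡ true → S y ≡ true → R x y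

    IsMaximalRClique : (A → Bool) → Set r
    IsMaximalRClique S =
      IsRClique S × (∀ S′ → IsRClique S′ → (∀ x → S x ≡ true → S′ x ≡ true) → ∀ x → S′ x ≡ true → S x ≡ true)

    Lists : List A → (A → Bool) → Set
    Lists L S = (∀ x → x ∈ L → S x ≡ true) × (∀ x → S x ≡ true → x ∈ L)

    compatible : ∀ {S x L} → IsRClique S → S x ≡ true → (∀ y → y ∈ L → S y ≡ true) → All (R x) L
    compatible {S} {x} rclique Sx L⊆S = All.tabulate (λ {y} y∈L → rclique x y Sx (L⊆S y y∈L))

    compatible⇒∈maximal : ∀ {S L x} → IsMaximalRClique S → Lists L S → All (R x) L → S x ≡ true
    compatible⇒∈maximal {S} {L} {x} (rclique , maximal) (L⊆S , S⊆L) x-compatible =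
      maximal S+x rclique+x S⊆S+x x (cong (_∨ S x) (dec-true (x ≟ x) refl))
      where
      S+x : A → Bool
      S+x y = does (y ≟ x) ∨ S y
      S⊆S+x : ∀ y → S y ≡ true → S+x y ≡ true
      S⊆S+x y Sy = trans (cong (does (y ≟ x) ∨_) Sy) (∨-zeroʳ _)
      member : ∀ y → S+x y ≡ true → y ∈ L ⊎ y ≡ x
      member y y∈S+x with y ≟ x
      ... | yes y≡x = inj₂ y≡x
      ... | no  _   = inj₁ (S⊆L y y∈S+x)
      rclique+x : IsRClique S+x
      rclique+x y z y∈ z∈ with member y y∈ | member z z∈
      ... | inj₁ y∈L  | inj₁ z∈L  = rclique y z (L⊆S y y∈L) (L⊆S z z∈L)
      ... | inj₁ y∈L  | inj₂ refl = R-sym (All.lookup x-compatible y∈L)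
      ... | inj₂ refl | inj₁ z∈L  = All.lookup x-compatible z∈L
      ... | inj₂ refl | inj₂ refl = R-refl

    Pairwise : List A → Set r
    Pairwise L = ∀ x y → x ∈ L → y ∈ L → R x y

    extend : List A → List A → List A
    extend chosen []       = chosen
    extend chosen (x ∷ xs) with all? (R? x) chosen
    ... | yes _ = extend (x ∷ chosen) xs
    ... | no  _ = extend chosen xs

    ⊆-extend : ∀ chosen xs {y} → y ∈ chosen → y ∈ extend chosen xs
    ⊆-extend chosen []       y∈ = y∈
    ⊆-extend chosen (x ∷ xs) y∈ with all? (R? x) chosen
    ... | yes _ = ⊆-extend (x ∷ chosen) xs (there y∈)
    ... | no  _ = ⊆-extend chosen xs y∈

    extend-pairwise : ∀ chosen xs → Pairwise chosen → Pairwise (extend chosen xs)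
    extend-pairwise chosen []       pw = pw
    extend-pairwise chosen (x ∷ xs) pw with all? (R? x) chosen
    ... | no  _            = extend-pairwise chosen xs pw
    ... | yes x-compatible = extend-pairwise (x ∷ chosen) xs pw′
      where
      pw′ : Pairwise (x ∷ chosen)
      pw′ _ _ (here refl) (here refl) = R-refl
      pw′ _ _ (here refl) (there z∈)  = All.lookup x-compatible z∈
      pw′ _ _ (there y∈)  (here refl) = R-sym (All.lookup x-compatible y∈)
      pw′ y z (there y∈)  (there z∈)  = pw y z y∈ z∈

    extend-saturated : ∀ chosen xs {y} → y ∈ xs → All (R y) (extend chosen xs) → y ∈ extend chosen xs
    extend-saturated chosen (x ∷ xs) y∈ y-compatible with all? (R? x) chosen | y∈
    ... | yes _ | here refl = ⊆-extend (x ∷ chosen) xs (here refl)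
    ... | no incompatible | here refl =
      ⊥-elim (incompatible (All.tabulate (λ z∈ → All.lookup y-compatible (⊆-extend chosen xs z∈))))
    ... | yes _ | there y∈xs = extend-saturated (x ∷ chosen) xs y∈xs y-compatible
    ... | no  _ | there y∈xs = extend-saturated chosen xs y∈xs y-compatible

    maximalRClique-∋ : ∀ x → ∃ λ S → IsMaximalRClique S × S x ≡ true
    maximalRClique-∋ x = ⟦ L ⟧ , (rclique , maximal) , ∈⇒∈⟦⟧ (⊆-extend (x ∷ []) elements (here refl))
      where
      L : List A
      L = extend (x ∷ []) elements
      rclique : IsRClique ⟦ L ⟧
      rclique y z y∈ z∈ = extend-pairwise (x ∷ []) elements singleton y z (∈⟦⟧⇒∈ y∈) (∈⟦⟧⇒∈ z∈)
        where
        singleton : Pairwise (x ∷ [])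
        singleton _ _ (here refl) (here refl) = R-refl
      maximal : ∀ S′ → IsRClique S′ → (∀ y → ⟦ L ⟧ y ≡ true → S′ y ≡ true)
              → ∀ y → S′ y ≡ true → ⟦ L ⟧ y ≡ true
      maximal S′ rclique′ L⊆S′ y S′y =
        ∈⇒∈⟦⟧ (extend-saturated (x ∷ []) elements (complete y)
                 (compatible rclique′ S′y (λ z z∈L → L⊆S′ z (∈⇒∈⟦⟧ z∈L))))

    module MaximalSearch {p} {P : Pred (List A) p} (P? : Relation.Unary.Decidable P) where

      atLeaf : List A → List A → Bool
      atLeaf chosen []      = does (P? chosen)
      atLeaf chosen (_ ∷ _) = true

      -- Bron–Kerbosch without pivoting: excluded collects skipped candidates compatible with chosen,
      -- so a leaf is a maximal R-clique exactly when excluded is empty.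
      search : ℕ → List A → List A → List A → Bool
      search _       chosen excluded []       = atLeaf chosen excluded
      search zero    _      _        (_ ∷ _)  = false
      search (suc n) chosen excluded (x ∷ xs) =
        search n (x ∷ chosen) (filter (R? x) excluded) (filter (R? x) xs) ∧ search n chosen (x ∷ excluded) xs

      allMaximalRCliquesSatisfy : Bool
      allMaximalRCliquesSatisfy = search (length elements) [] [] elements

      search-sound : ∀ n chosen excluded candidates → T (search n chosen excluded candidates)
                   → ∀ {S} → IsMaximalRClique S
                   → (∀ x → x ∈ chosen → S x ≡ true)
                   → (∀ x → S x ≡ true → x ∈ chosen ⊎ x ∈ candidates)
                   → All (λ c → All (R c) chosen) candidates
                   → All (λ e → S e ≢ true × All (R e) chosen) excluded
                   → ∃ λ L → P L × Lists L S
      search-sound _ chosen [] [] ok _ chosen⊆S S⊆ _ _ with P? chosen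
      ... | yes P-chosen = chosen , P-chosen , chosen⊆S , λ x Sx → [ id , (λ ()) ] (S⊆ x Sx)
      search-sound _ chosen (e ∷ _) [] _ maximal-S chosen⊆S S⊆ _ ((e∉S , e-compatible) ∷ _) =
        ⊥-elim (e∉S (compatible⇒∈maximal maximal-S (chosen⊆S , λ x Sx → [ id , (λ ()) ] (S⊆ x Sx))
                                         e-compatible))
      search-sound (suc n) chosen excluded (x ∷ xs) ok {S} maximal-S@(rclique , _) chosen⊆S S⊆
                   (x-compatible ∷ xs-compatible) excluded-ok with S x in Sx
      ... | true =
        search-sound n (x ∷ chosen) (filter (R? x) excluded) (filter (R? x) xs)
          (proj₁ (Equivalence.to T-∧ ok)) maximal-S x∷chosen⊆S S⊆′
          (All.zipWith (λ (Rxc , c-compatible) → R-sym Rxc ∷ c-compatible)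
                       (all-filter (R? x) xs , filter⁺ (R? x) xs-compatible))
          (All.zipWith (λ (Rxe , e∉S , e-compatible) → e∉S , R-sym Rxe ∷ e-compatible)
                       (all-filter (R? x) excluded , filter⁺ (R? x) excluded-ok))
        where
        x∷chosen⊆S : ∀ y → y ∈ x ∷ chosen → S y ≡ true
        x∷chosen⊆S y (here refl)      = Sx
        x∷chosen⊆S y (there y∈chosen) = chosen⊆S y y∈chosen
        S⊆′ : ∀ y → S y ≡ true → y ∈ x ∷ chosen ⊎ y ∈ filter (R? x) xs
        S⊆′ y Sy with S⊆ y Sy
        ... | inj₁ y∈chosen     = inj₁ (there y∈chosen)
        ... | inj₂ (here y≡x)   = inj₁ (here y≡x)
        ... | inj₂ (there y∈xs) = inj₂ (∈-filter⁺ (R? x) y∈xs (rclique x y Sx Sy))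
      ... | false =
        search-sound n chosen (x ∷ excluded) xs (proj₂ (Equivalence.to T-∧ ok))
          maximal-S chosen⊆S S⊆′ xs-compatible ((x∉S , x-compatible) ∷ excluded-ok)
        where
        x∉S : S x ≢ true
        x∉S Sx≡true = case trans (sym Sx) Sx≡true of λ ()
        S⊆′ : ∀ y → S y ≡ true → y ∈ chosen ⊎ y ∈ xs
        S⊆′ y Sy with S⊆ y Sy
        ... | inj₁ y∈chosen     = inj₁ y∈chosen
        ... | inj₂ (here refl)  = ⊥-elim (x∉S Sy)
        ... | inj₂ (there y∈xs) = inj₂ y∈xs

      everyMaximalRClique-satisfies : T allMaximalRCliquesSatisfy
                                    → ∀ S → IsMaximalRClique S → ∃ λ L → P L × Lists L S
      everyMaximalRClique-satisfies ok S maximal-S =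
        search-sound (length elements) [] [] elements ok maximal-S (λ _ ()) (λ x _ → inj₂ (complete x))
          (All.tabulate (λ _ → [])) []

module FiniteGraph (G : Graph)
                   (_≟_ : DecidableEquality (Graph.Vertex G)) (_~?_ : Decidable (Graph._~_ G))
                   (~-sym : Symmetric (Graph._~_ G)) (~-irrefl : ∀ {u} → ¬ Graph._~_ G u u)
                   (vertices : List (Graph.Vertex G)) (complete : ∀ v → v ∈ vertices) where
  open Graph G
  open Enumerated _≟_ vertices complete public

  module Cliques = RCliques {R = λ u v → u ~ v ⊎ u ≡ v} (λ u v → u ~? v ⊎-dec u ≟ v) (inj₂ refl)
                         [ inj₁ ∘ ~-sym , inj₂ ∘ sym ]
  -- The (maximal) R-cliques of Independent are, definitionally, the (maximal) independent sets of G.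
  module Independent = RCliques {R = λ u v → ¬ u ~ v} (λ u v → ¬? (u ~? v)) ~-irrefl (_∘ ~-sym)

  clique⇒rClique : ∀ {C} → IsClique G C → Cliques.IsRClique C
  clique⇒rClique clique-C u v Cu Cv with u ≟ v
  ... | yes u≡v = inj₂ u≡v
  ... | no  u≢v = inj₁ (clique-C u v Cu Cv u≢v)

  rClique⇒clique : ∀ {C} → Cliques.IsRClique C → IsClique G C
  rClique⇒clique rclique u v Cu Cv u≢v = [ id , ⊥-elim ∘ u≢v ] (rclique u v Cu Cv)

  maximalClique⇒maximalRClique : ∀ {C} → IsMaximalClique G C → Cliques.IsMaximalRClique C
  maximalClique⇒maximalRClique (clique-C , maximal) =
    clique⇒rClique clique-C , λ S rclique-S → maximal S (rClique⇒clique rclique-S)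

  inMaximalIndependent : ∀ v → ∃ λ I → IsMaximalIndependent G I × I v ≡ true
  inMaximalIndependent = Independent.maximalRClique-∋

digitsFrom : ∀ {n} → ℕ → ℕ → Subset n → ℕ
digitsFrom i acc []          = acc
digitsFrom i acc (true  ∷ p) = digitsFrom (suc i) (10 * acc + i) p
digitsFrom i acc (false ∷ p) = digitsFrom (suc i) acc p

numeral : ∀ {n} → Subset n → ℕ
numeral = digitsFrom 0 0

-- A Fano plane on the points 0, …, 6 is listed by its seven lines, the line {a, b, c} with
-- a < b < c being written as the decimal numeral abc, i.e. as numeral {a, b, c}.
FanoPlane : Set
FanoPlane = List ℕ

fanoPlanes : List FanoPlane
fanoPlanes =
    (012 ∷ 034 ∷ 056 ∷ 135 ∷ 146 ∷ 236 ∷ 245 ∷ [])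
  ∷ (012 ∷ 034 ∷ 056 ∷ 136 ∷ 145 ∷ 235 ∷ 246 ∷ [])
  ∷ (012 ∷ 035 ∷ 046 ∷ 134 ∷ 156 ∷ 236 ∷ 245 ∷ [])
  ∷ (012 ∷ 035 ∷ 046 ∷ 136 ∷ 145 ∷ 234 ∷ 256 ∷ [])
  ∷ (012 ∷ 036 ∷ 045 ∷ 134 ∷ 156 ∷ 235 ∷ 246 ∷ [])
  ∷ (012 ∷ 036 ∷ 045 ∷ 135 ∷ 146 ∷ 234 ∷ 256 ∷ [])
  ∷ (013 ∷ 024 ∷ 056 ∷ 125 ∷ 146 ∷ 236 ∷ 345 ∷ [])
  ∷ (013 ∷ 024 ∷ 056 ∷ 126 ∷ 145 ∷ 235 ∷ 346 ∷ [])
  ∷ (013 ∷ 025 ∷ 046 ∷ 124 ∷ 156 ∷ 236 ∷ 345 ∷ [])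
  ∷ (013 ∷ 025 ∷ 046 ∷ 126 ∷ 145 ∷ 234 ∷ 356 ∷ [])
  ∷ (013 ∷ 026 ∷ 045 ∷ 124 ∷ 156 ∷ 235 ∷ 346 ∷ [])
  ∷ (013 ∷ 026 ∷ 045 ∷ 125 ∷ 146 ∷ 234 ∷ 356 ∷ [])
  ∷ (014 ∷ 023 ∷ 056 ∷ 125 ∷ 136 ∷ 246 ∷ 345 ∷ [])
  ∷ (014 ∷ 023 ∷ 056 ∷ 126 ∷ 135 ∷ 245 ∷ 346 ∷ [])
  ∷ (014 ∷ 025 ∷ 036 ∷ 123 ∷ 156 ∷ 246 ∷ 345 ∷ [])
  ∷ (014 ∷ 025 ∷ 036 ∷ 126 ∷ 135 ∷ 234 ∷ 456 ∷ [])
  ∷ (014 ∷ 026 ∷ 035 ∷ 123 ∷ 156 ∷ 245 ∷ 346 ∷ [])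
  ∷ (014 ∷ 026 ∷ 035 ∷ 125 ∷ 136 ∷ 234 ∷ 456 ∷ [])
  ∷ (015 ∷ 023 ∷ 046 ∷ 124 ∷ 136 ∷ 256 ∷ 345 ∷ [])
  ∷ (015 ∷ 023 ∷ 046 ∷ 126 ∷ 134 ∷ 245 ∷ 356 ∷ [])
  ∷ (015 ∷ 024 ∷ 036 ∷ 123 ∷ 146 ∷ 256 ∷ 345 ∷ [])
  ∷ (015 ∷ 024 ∷ 036 ∷ 126 ∷ 134 ∷ 235 ∷ 456 ∷ [])
  ∷ (015 ∷ 026 ∷ 034 ∷ 123 ∷ 146 ∷ 245 ∷ 356 ∷ [])
  ∷ (015 ∷ 026 ∷ 034 ∷ 124 ∷ 136 ∷ 235 ∷ 456 ∷ [])
  ∷ (016 ∷ 023 ∷ 045 ∷ 124 ∷ 135 ∷ 256 ∷ 346 ∷ [])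
  ∷ (016 ∷ 023 ∷ 045 ∷ 125 ∷ 134 ∷ 246 ∷ 356 ∷ [])
  ∷ (016 ∷ 024 ∷ 035 ∷ 123 ∷ 145 ∷ 256 ∷ 346 ∷ [])
  ∷ (016 ∷ 024 ∷ 035 ∷ 125 ∷ 134 ∷ 236 ∷ 456 ∷ [])
  ∷ (016 ∷ 025 ∷ 034 ∷ 123 ∷ 145 ∷ 246 ∷ 356 ∷ [])
  ∷ (016 ∷ 025 ∷ 034 ∷ 124 ∷ 135 ∷ 236 ∷ 456 ∷ [])
  ∷ []

module J731 where
  open Johnson 7 3 1
  open Graph (J 7 3 1)

  ~-sym : Symmetric _~_
  ~-sym {p , _} {q , _} = trans (cong ∣_∣ (∩-comm q p))

  ~-irrefl : ∀ {u} → ¬ u ~ u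
  ~-irrefl {p , ∣p∣≡3} loop = case trans (sym (trans (cong ∣_∣ (∩-idem p)) ∣p∣≡3)) loop of λ ()

  open FiniteGraph (J 7 3 1) _≟ᵥ_ _~?_ (λ {u} {v} → ~-sym {u} {v}) (λ {u} → ~-irrefl {u})
                   (subsetsOfSize 7 3) ∈-subsetsOfSize
  open import Data.List.Membership.DecPropositional {A = ℕ} _≟_ using () renaming (_∈?_ to _∈ₙ?_)

  vertices : List Vertex
  vertices = subsetsOfSize 7 3

  OnPlane : FanoPlane → Vertex → Set
  OnPlane F u = numeral (proj₁ u) ∈ F

  onPlane? : ∀ F u → Dec (OnPlane F u)
  onPlane? F u = numeral (proj₁ u) ∈ₙ? F

  plane : FanoPlane → Vertex → Bool
  plane F u = does (onPlane? F u)

  Disjoint : FanoPlane → FanoPlane → Set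
  Disjoint F G = All (_∉ G) F

  disjoint? : ∀ F G → Dec (Disjoint F G)
  disjoint? F G = all? (λ a → ¬? (a ∈ₙ? G)) F

  module CliqueSearch = Cliques.MaximalSearch (λ L → any? (λ F → all? (onPlane? F) L) fanoPlanes)
  module IndependentSearch = Independent.MaximalSearch (λ L → all? (λ F → any? (onPlane? F) L) fanoPlanes)

  -- The exhaustive checks are abstract: unfolding them would make Agda re-run the searches
  -- wherever a term built from them is normalised.
  abstract
    planes-areCliques : All (λ F → All (λ u → plane F u ≡ true →
                          All (λ v → plane F v ≡ true → u ~ v ⊎ u ≡ v) vertices) vertices) fanoPlanes
    planes-areCliques = toWitness {a? = all? (λ F → all? (λ u → (plane F u Bool.≟ true) →-dec
                          all? (λ v → (plane F v Bool.≟ true) →-dec (u ~? v ⊎-dec u ≟ᵥ v)) vertices)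
                          vertices) fanoPlanes} _

    numerals-nameVertices : All (All (λ a → Any (λ u → numeral (proj₁ u) ≡ a) vertices)) fanoPlanes
    numerals-nameVertices =
      toWitness {a? = all? (all? (λ a → any? (λ u → numeral (proj₁ u) ≟ a) vertices)) fanoPlanes} _

    noThreeDisjointPlanes : All (λ F → All (λ G → Disjoint F G →
                              All (λ H → ¬ (Disjoint F H × Disjoint G H)) fanoPlanes) fanoPlanes) fanoPlanes
    noThreeDisjointPlanes = toWitness {a? = all? (λ F → all? (λ G → disjoint? F G →-dec
                              all? (λ H → ¬? (disjoint? F H ×-dec disjoint? G H)) fanoPlanes)
                              fanoPlanes) fanoPlanes} _

    twoPlanes-missVertex : All (λ F → All (λ G →
                             Any (λ u → ¬ OnPlane F u × ¬ OnPlane G u) vertices) fanoPlanes) fanoPlanes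
    twoPlanes-missVertex = toWitness {a? = all? (λ F → all? (λ G →
                             any? (λ u → ¬? (onPlane? F u) ×-dec ¬? (onPlane? G u)) vertices)
                             fanoPlanes) fanoPlanes} _

    maximalClique-listed : ∀ C → Cliques.IsMaximalRClique C
                         → ∃ λ L → Any (λ F → All (OnPlane F) L) fanoPlanes × Cliques.Lists L C
    maximalClique-listed = CliqueSearch.everyMaximalRClique-satisfies _

    maximalIndependent-listed : ∀ I → IsMaximalIndependent (J 7 3 1) I
                              → ∃ λ L → All (λ F → Any (OnPlane F) L) fanoPlanes × Independent.Lists L I
    maximalIndependent-listed = IndependentSearch.everyMaximalRClique-satisfies _

  plane-isClique : ∀ {F} → F ∈ fanoPlanes → IsClique (J 7 3 1) (plane F)
  plane-isClique F∈ u v u∈F v∈F u≢v = [ id , ⊥-elim ∘ u≢v ]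
    (All.lookup (All.lookup (All.lookup planes-areCliques F∈) (∈-subsetsOfSize u) u∈F) (∈-subsetsOfSize v) v∈F)

  maximalClique-isPlane : ∀ {C} → IsMaximalClique (J 7 3 1) C
                        → ∃ λ F → F ∈ fanoPlanes × (∀ u → C u ≡ true ⇔ OnPlane F u)
  maximalClique-isPlane {C} maximal-C@(_ , maximal)
    with maximalClique-listed C (maximalClique⇒maximalRClique maximal-C)
  ... | L , inSomePlane , L⊆C , C⊆L with find inSomePlane
  ... | F , F∈ , L-onF = F , F∈ , λ u → mk⇔ (C⊆F u) (F⊆C u)
    where
    C⊆F : ∀ u → C u ≡ true → OnPlane F u
    C⊆F u Cu = All.lookup L-onF (C⊆L u Cu)
    F⊆C : ∀ u → OnPlane F u → C u ≡ true
    F⊆C u u∈F = maximal (plane F) (plane-isClique F∈) (λ v Cv → dec-true (onPlane? F v) (C⊆F v Cv)) u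
                        (dec-true (onPlane? F u) u∈F)

  maximalIndependent-meetsPlane : ∀ {I F} → IsMaximalIndependent (J 7 3 1) I → F ∈ fanoPlanes
                                → ∃ λ u → I u ≡ true × OnPlane F u
  maximalIndependent-meetsPlane {I} maximal-I F∈ =
    let L , meetsPlanes , L⊆I , _ = maximalIndependent-listed I maximal-I
        u , u∈L , u∈F = find (All.lookup meetsPlanes F∈)
    in u , L⊆I u u∈L , u∈F

  cis : IsCIS (J 7 3 1)
  cis C maximal-C@(clique-C , _) = clique-C , λ I maximal-I →
    let F , F∈ , C⇔F = maximalClique-isPlane maximal-C
        u , Iu , u∈F = maximalIndependent-meetsPlane maximal-I F∈
    in u , Equivalence.from (C⇔F u) u∈F , Iu

  module _ (c : Vertex → ℕ) (strong : ∀ v → IsStrongClique (J 7 3 1) (block (J 7 3 1) c v)) where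

    blockIsPlane : ∀ v → ∃ λ F → F ∈ fanoPlanes × (∀ u → block (J 7 3 1) c v u ≡ true ⇔ OnPlane F u)
    blockIsPlane v = maximalClique-isPlane (strongClique⇒maximal inMaximalIndependent (strong v))

    blockPlane : Vertex → FanoPlane
    blockPlane v = proj₁ (blockIsPlane v)

    blockPlane∈ : ∀ v → blockPlane v ∈ fanoPlanes
    blockPlane∈ v = proj₁ (proj₂ (blockIsPlane v))

    onBlockPlane⇔ : ∀ v u → c u ≡ c v ⇔ OnPlane (blockPlane v) u
    onBlockPlane⇔ v u = proj₂ (proj₂ (blockIsPlane v)) u ⇔-∘ ⇔-sym (∈block⇔ {G = J 7 3 1} c v u)

    offBlockPlane⇒disjoint : ∀ {v w} → ¬ OnPlane (blockPlane v) w → Disjoint (blockPlane v) (blockPlane w)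
    offBlockPlane⇒disjoint {v} {w} w∉Fv = All.tabulate λ {a} a∈Fv a∈Fw →
      let u , _ , numeral≡a = find (All.lookup (All.lookup numerals-nameVertices (blockPlane∈ v)) a∈Fv)
          label : ∀ x → a ∈ blockPlane x → c u ≡ c x
          label x a∈Fx = Equivalence.from (onBlockPlane⇔ x u) (subst (_∈ blockPlane x) (sym numeral≡a) a∈Fx)
      in w∉Fv (Equivalence.to (onBlockPlane⇔ v w) (trans (sym (label w a∈Fw)) (label v a∈Fv)))

    v₀ : Vertex
    v₀ = (true ∷ true ∷ true ∷ false ∷ false ∷ false ∷ false ∷ []) , refl

    noStrongPartition : ⊥
    noStrongPartition =
      let missed = λ v w → find (All.lookup (All.lookup twoPlanes-missVertex (blockPlane∈ v)) (blockPlane∈ w))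
          x , _ , x∉F₀ , _    = missed v₀ v₀
          z , _ , z∉F₀ , z∉Fx = missed v₀ x
      in All.lookup (All.lookup (All.lookup noThreeDisjointPlanes (blockPlane∈ v₀)) (blockPlane∈ x)
                                (offBlockPlane⇒disjoint x∉F₀))
                    (blockPlane∈ z) (offBlockPlane⇒disjoint z∉F₀ , offBlockPlane⇒disjoint z∉Fx)

  notLocalizable : ¬ IsLocalizable (J 7 3 1)
  notLocalizable (c , strong) = noStrongPartition c strong

theorem4p3 : IsVertexTransitive (J 7 3 1) × IsCIS (J 7 3 1) × ¬ IsLocalizable (J 7 3 1)
theorem4p3 = Johnson.vertexTransitive 7 3 1 , J731.cis , J731.notLocalizable
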